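{- For every prime $p\ge 5$, $$\sum_{j=0}^{p}T(p,j)\equiv \frac{1}{2}\left(1+3^p\right)\pmod{p^2},$$ and $$\sum_{j=0}^{p-1}T(p-1,j)\equiv \frac{1}{2}\left(1+\left(\frac{p}{3}\right)\right)\pmod{p}.$$
   Context: For an integer $n\ge 0$ and an integer $j$, the trinomial coefficient $T(n,j)$ is the coefficient of $x^j$ in the Laurent polynomial $(1+x+x^{ -1})^n$, i.e. $(1+x+x^{ -1})^n=\sum_{j=-n}^{n}T(n,j)x^j$ (and $T(n,j)=0$ for $|j|>n$). Here $\left(\frac{p}{3}\right)$ denotes the Legendre symbol, equal to $1$ if $p\equiv 1\pmod 3$ and $-1$ if $p\equiv 2\pmod 3$. Congruences between rationals are understood in the ring of rationals with denominators prime to $p$. -}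

module Defs where

open import Data.Nat using (ℕ; zero; suc; _%_)
open import Data.Integer using (ℤ; +_; -[1+_]; _+_; _-_; 1ℤ; -1ℤ; 0ℤ)
open import Data.List using (List; map; upTo)
open import Data.Nat.ListAction using (sum)

-- Trinomial coefficient T(n,j): coefficient of x^j in (1 + x + x⁻¹)^n,
-- defined by the recursion (1+x+x⁻¹)^(n+1) = (1+x+x⁻¹)^n · (1+x+x⁻¹).
-- T(0,0) = 1, T(0,j) = 0 for j ≠ 0.
T : ℕ → ℤ → ℕ
T zero (+ zero)    = 1
T zero (+ suc _)   = 0
T zero -[1+ _ ]    = 0
T (suc n) j = T n (j - 1ℤ) Data.Nat.+ T n j Data.Nat.+ T n (j + 1ℤ)

sumT : ℕ → ℕ → ℕ
sumT n m = sum (map (λ j → T n (+ j)) (upTo (suc m)))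

-- Legendre symbol (p/3) for a prime p ≠ 3: 1 if p ≡ 1 mod 3, -1 if p ≡ 2 mod 3
-- (0 if 3 ∣ p, never used for p ≥ 5 prime).
legendre3 : ℕ → ℤ
legendre3 p with p % 3
... | 1 = 1ℤ
... | 2 = -1ℤ
... | _ = 0ℤ

-- Write S(n) = Σ_{j=0}^{n} T(n,j).  The proof has four ingredients.
--  * Row sums: from the recursion and the symmetry T(n,-j) = T(n,j) one gets
--    2·S(n) = 3^n + T(n,0), so both congruences concern central coefficients.
--  * Row p: the identities j·T(n+1,j) = (n+1)(T(n,j-1) - T(n,j+1)) and
--    k·C(n+1,k) = (n+1)·C(n,k-1) show p ∣ T(p,j) and p ∣ C(p,j) for 0 < j < p.
--  * Finite differences: as Δ(x⁻¹ + 1 + x) = x⁻¹ - x² for Δ = 1 - x, the number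
--    Δⁿ T(n,·)(s) = Σ_k (-1)^k C(n,k) T(n,s+k) vanishes unless 3 ∣ s - n.  For
--    n = p, s = 0 every middle term is divisible by p², so T(p,0) ≡ 1 (mod p²);
--    with the row sum this is the first congruence.
--  * Row p - 1: p ∣ T(p,j) is a three-term recurrence for T(p-1, p-1-k) in k, so
--    modulo p these numbers follow the 3-periodic sequence (k+1 / 3) = 1, -1, 0, …,
--    whence T(p-1,0) ≡ (p/3).  The row sum of row p also yields Fermat's
--    3^(p-1) ≡ 1 (mod p), and together these give the second congruence.
module Submission where

open import Defs
open import Data.Nat using (ℕ; _≥_; _^_; _∸_)
open import Data.Nat.Primality using (Prime)
open import Data.Integer using (ℤ; +_; _+_; _-_; _*_; 1ℤ)
open import Data.Integer.Divisibility using (_∣_)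
open import Data.Product using (_×_)

open import Data.Nat as ℕ using (zero; suc; s≤s; _<_; _≤_)
import Data.Nat.Properties as ℕP
open import Data.Nat.Combinatorics
  using (_C_; nCn≡1; nC1≡n; k>n⇒nCk≡0; nCk+nC[k+1]≡[n+1]C[k+1])
open import Data.Nat.DivMod using (_%_; _/_; m≡m%n+[m/n]*n; m%n<n)
open import Data.Nat.Divisibility using (∣⇒≤; m%n≡0⇒n∣m) renaming (_∣_ to _∣ℕ_)
open import Data.Nat.Primality using (euclidsLemma; composite; ¬prime[1])
open import Data.Integer as ℤ using (-[1+_]; -_; 0ℤ; -1ℤ; ∣_∣)
import Data.Integer.Properties as ℤP
open import Data.Integer.Tactic.RingSolver using (solve-∀)
import Data.Nat.Tactic.RingSolver as ℕSolver
-- Signed divisibility on ℤ; the unsigned _∣_ above is the one of the statement.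
open import Data.Integer.Divisibility.Signed as Signed using (divides) renaming (_∣_ to _∣ℤ_)
open import Data.List using (map; applyUpTo)
open import Data.Nat.ListAction using (sum)
open import Data.Product using (_,_; proj₂)
open import Data.Sum using (inj₁; inj₂)
open import Data.Empty using (⊥-elim)
open import Relation.Nullary using (¬_)
open import Relation.Binary.PropositionalEquality

open ≡-Reasoning

-- ∑ N f = f 0 + f 1 + ⋯ + f (N - 1).
∑ : ℕ → (ℕ → ℤ) → ℤ
∑ zero    f = 0ℤ
∑ (suc N) f = f 0 + ∑ N (λ k → f (suc k))

∑-cong : ∀ N {f g : ℕ → ℤ} → (∀ k → f k ≡ g k) → ∑ N f ≡ ∑ N g
∑-cong zero    f≡g = refl
∑-cong (suc N) f≡g = cong₂ _+_ (f≡g 0) (∑-cong N (λ k → f≡g (suc k)))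

∑-last : ∀ N (f : ℕ → ℤ) → ∑ (suc N) f ≡ ∑ N f + f N
∑-last zero    f = trans (ℤP.+-identityʳ (f 0)) (sym (ℤP.+-identityˡ (f 0)))
∑-last (suc N) f = begin
  f 0 + ∑ (suc N) (λ k → f (suc k))   ≡⟨ cong (λ x → f 0 + x) (∑-last N (λ k → f (suc k))) ⟩
  f 0 + (∑ N (λ k → f (suc k)) + f (suc N)) ≡⟨ ℤP.+-assoc (f 0) _ _ ⟨
  f 0 + ∑ N (λ k → f (suc k)) + f (suc N) ∎

∑-+ : ∀ N (f g : ℕ → ℤ) → ∑ N (λ k → f k + g k) ≡ ∑ N f + ∑ N g
∑-+ zero    f g = refl
∑-+ (suc N) f g = trans (cong (λ x → f 0 + g 0 + x) (∑-+ N (λ k → f (suc k)) (λ k → g (suc k))))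
                        (interchange (f 0) (g 0) _ _)
  where
  interchange : ∀ a b c d → a + b + (c + d) ≡ a + c + (b + d)
  interchange = solve-∀

∑-- : ∀ N (f g : ℕ → ℤ) → ∑ N (λ k → f k - g k) ≡ ∑ N f - ∑ N g
∑-- zero    f g = refl
∑-- (suc N) f g = trans (cong (λ x → f 0 - g 0 + x) (∑-- N (λ k → f (suc k)) (λ k → g (suc k))))
                        (interchange (f 0) (g 0) _ _)
  where
  interchange : ∀ a b c d → a - b + (c - d) ≡ a + c - (b + d)
  interchange = solve-∀

∑-divisible : ∀ N {d} (f : ℕ → ℤ) → (∀ k → k < N → d ∣ℤ f k) → d ∣ℤ ∑ N f
∑-divisible zero    f d∣f = divides 0ℤ refl
∑-divisible (suc N) f d∣f = Signed.∣m∣n⇒∣m+n (d∣f 0 (s≤s ℕ.z≤n))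
  (∑-divisible N (λ k → f (suc k)) (λ k k<N → d∣f (suc k) (s≤s k<N)))

sum-applyUpTo : ∀ N (g f : ℕ → ℕ) → + sum (map g (applyUpTo f N)) ≡ ∑ N (λ k → + g (f k))
sum-applyUpTo zero    g f = refl
sum-applyUpTo (suc N) g f = cong (λ x → + g (f 0) + x) (sum-applyUpTo N g (λ k → f (suc k)))

-- Trinomial coefficients as integers; Tℤ (suc n) is definitionally nbr (Tℤ n) below.
Tℤ : ℕ → ℤ → ℤ
Tℤ n j = + T n j

T-vanish : ∀ n m → n < m → T n (+ m) ≡ 0
T-vanish zero    (suc m) _         = refl
T-vanish (suc n) (suc m) (s≤s n<m) = cong₂ ℕ._+_
  (cong₂ ℕ._+_ (T-vanish n m n<m) (T-vanish n (suc m) (ℕP.m<n⇒m<1+n n<m)))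
  (T-vanish n (suc m ℕ.+ 1) (ℕP.m≤n⇒m≤n+o 1 (ℕP.m<n⇒m<1+n n<m)))

T-top : ∀ n → T n (+ n) ≡ 1
T-top zero    = refl
T-top (suc n) = cong₂ ℕ._+_ (cong₂ ℕ._+_ (T-top n) (T-vanish n (suc n) ℕP.≤-refl))
  (T-vanish n (suc n ℕ.+ 1) (ℕP.m≤n⇒m≤n+o 1 ℕP.≤-refl))

T-row₀ : ∀ s → s ≢ 0ℤ → T 0 s ≡ 0
T-row₀ (+ zero)  s≢0 = ⊥-elim (s≢0 refl)
T-row₀ (+ suc s) s≢0 = refl
T-row₀ -[1+ s ]  s≢0 = refl

-- Symmetry T(n,-j) = T(n,j), as (1 + x + x⁻¹)ⁿ is invariant under x ↦ x⁻¹.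
T-sym : ∀ n j → T n (- j) ≡ T n j
T-sym zero    (+ zero)  = refl
T-sym zero    (+ suc j) = refl
T-sym zero    -[1+ j ]  = refl
T-sym (suc n) j = begin
  T n (- j - 1ℤ) ℕ.+ T n (- j) ℕ.+ T n (- j + 1ℤ)
    ≡⟨ cong₂ ℕ._+_ (cong₂ ℕ._+_ (reflect (j + 1ℤ) (neg-pred j)) (T-sym n j)) (reflect (j - 1ℤ) (neg-succ j)) ⟩
  T n (j + 1ℤ) ℕ.+ T n j ℕ.+ T n (j - 1ℤ)
    ≡⟨ reverse (T n (j + 1ℤ)) (T n j) (T n (j - 1ℤ)) ⟩
  T n (j - 1ℤ) ℕ.+ T n j ℕ.+ T n (j + 1ℤ) ∎
  where
  reflect : ∀ i {k} → k ≡ - i → T n k ≡ T n i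
  reflect i refl = T-sym n i
  neg-pred : ∀ j → - j - 1ℤ ≡ - (j + 1ℤ)
  neg-pred = solve-∀
  neg-succ : ∀ j → - j + 1ℤ ≡ - (j - 1ℤ)
  neg-succ = solve-∀
  reverse : ∀ a b c → a ℕ.+ b ℕ.+ c ≡ c ℕ.+ b ℕ.+ a
  reverse = ℕSolver.solve-∀

rowSum : ℕ → ℤ
rowSum n = ∑ (suc n) (λ j → Tℤ n (+ j))

sumT-as-rowSum : ∀ n → + sumT n n ≡ rowSum n
sumT-as-rowSum n = sum-applyUpTo (suc n) (λ j → T n (+ j)) (λ j → j)

rowSum-extend : ∀ n → ∑ (suc (suc n)) (λ j → Tℤ n (+ j)) ≡ rowSum n
rowSum-extend n = begin
  ∑ (suc (suc n)) (λ j → Tℤ n (+ j))       ≡⟨ ∑-last (suc n) (λ j → Tℤ n (+ j)) ⟩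
  rowSum n + Tℤ n (+ suc n)                ≡⟨ cong (λ x → rowSum n + + x) (T-vanish n (suc n) ℕP.≤-refl) ⟩
  rowSum n + 0ℤ                            ≡⟨ ℤP.+-identityʳ (rowSum n) ⟩
  rowSum n                                 ∎

-- Summing T(n+1,j) = T(n,j-1) + T(n,j) + T(n,j+1) over 0 ≤ j ≤ n+1 counts S(n) three
-- times, plus T(n,-1) = T(n,1) and minus T(n,0).
rowSum-step : ∀ n → rowSum (suc n) + Tℤ n (+ 0) ≡ Tℤ n (+ 1) + rowSum n + rowSum n + rowSum n
rowSum-step n = begin
  rowSum (suc n) + t₀
    ≡⟨ cong (_+ t₀) (trans (∑-+ (suc (suc n)) (λ j → left j + Tℤ n (+ j)) right)
                           (cong (_+ ∑ (suc (suc n)) right) (∑-+ (suc (suc n)) left (λ j → Tℤ n (+ j))))) ⟩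
  left 0 + rowSum n + ∑ (suc (suc n)) (λ j → Tℤ n (+ j)) + ∑ (suc (suc n)) right + t₀
    ≡⟨ regroup (left 0) (rowSum n) _ (∑ (suc (suc n)) right) t₀ ⟩
  left 0 + rowSum n + ∑ (suc (suc n)) (λ j → Tℤ n (+ j)) + (t₀ + ∑ (suc (suc n)) right)
    ≡⟨ cong₂ (λ a b → a + rowSum n + b + (t₀ + ∑ (suc (suc n)) right))
             (cong +_ (T-sym n (+ 1))) (rowSum-extend n) ⟩
  Tℤ n (+ 1) + rowSum n + rowSum n + (t₀ + ∑ (suc (suc n)) right)
    ≡⟨ cong (λ b → Tℤ n (+ 1) + rowSum n + rowSum n + b) right-sum ⟩
  Tℤ n (+ 1) + rowSum n + rowSum n + rowSum n ∎
  where
  t₀ : ℤ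
  t₀ = Tℤ n (+ 0)
  left right : ℕ → ℤ
  left  j = Tℤ n (+ j - 1ℤ)
  right j = Tℤ n (+ j + 1ℤ)
  regroup : ∀ a b c d e → a + b + c + d + e ≡ a + b + c + (e + d)
  regroup = solve-∀
  -- T(n,0) together with the shifted entries T(n,j+1) is the row extended by two zeros.
  right-sum : t₀ + ∑ (suc (suc n)) right ≡ rowSum n
  right-sum = begin
    t₀ + ∑ (suc (suc n)) right
      ≡⟨ cong (λ x → t₀ + x) (∑-cong (suc (suc n)) (λ j → cong (λ i → Tℤ n (+ i)) (ℕP.+-comm j 1))) ⟩
    ∑ (suc (suc (suc n))) (λ j → Tℤ n (+ j))
      ≡⟨ ∑-last (suc (suc n)) (λ j → Tℤ n (+ j)) ⟩
    ∑ (suc (suc n)) (λ j → Tℤ n (+ j)) + Tℤ n (+ suc (suc n))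
      ≡⟨ cong₂ (λ a b → a + + b) (rowSum-extend n) (T-vanish n (suc (suc n)) (ℕP.m<n⇒m<1+n ℕP.≤-refl)) ⟩
    rowSum n + 0ℤ
      ≡⟨ ℤP.+-identityʳ (rowSum n) ⟩
    rowSum n ∎

rowSum-doubled : ∀ n → + 2 * rowSum n ≡ + (3 ^ n) + Tℤ n (+ 0)
rowSum-doubled zero    = refl
rowSum-doubled (suc n) = begin
  + 2 * S′
    ≡⟨ twice S′ t₀ ⟩
  + 2 * (S′ + t₀) - + 2 * t₀
    ≡⟨ cong (λ x → + 2 * x - + 2 * t₀) (rowSum-step n) ⟩
  + 2 * (t₁ + S + S + S) - + 2 * t₀
    ≡⟨ expand t₁ S t₀ ⟩
  + 3 * (+ 2 * S) + (t₁ + t₀ + t₁) - + 3 * t₀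
    ≡⟨ cong (λ x → + 3 * x + (t₁ + t₀ + t₁) - + 3 * t₀) (rowSum-doubled n) ⟩
  + 3 * (P + t₀) + (t₁ + t₀ + t₁) - + 3 * t₀
    ≡⟨ collect P t₀ t₁ ⟩
  + 3 * P + (t₁ + t₀ + t₁)
    ≡⟨ cong₂ _+_ (sym (ℤP.pos-* 3 (3 ^ n))) (cong (λ x → + x + t₀ + t₁) (sym (T-sym n (+ 1)))) ⟩
  + (3 ^ suc n) + Tℤ (suc n) (+ 0) ∎
  where
  S′ S P t₀ t₁ : ℤ
  S′ = rowSum (suc n)
  S  = rowSum n
  P  = + (3 ^ n)
  t₀ = Tℤ n (+ 0)
  t₁ = Tℤ n (+ 1)
  twice : ∀ x y → + 2 * x ≡ + 2 * (x + y) - + 2 * y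
  twice = solve-∀
  expand : ∀ a s b → + 2 * (a + s + s + s) - + 2 * b ≡ + 3 * (+ 2 * s) + (a + b + a) - + 3 * b
  expand = solve-∀
  collect : ∀ p b a → + 3 * (p + b) + (a + b + a) - + 3 * b ≡ + 3 * p + (a + b + a)
  collect = solve-∀

prime-∣-cofactor : ∀ {p k} (x : ℤ) → Prime p → 0 < k → k < p → + p ∣ℤ + k * x → + p ∣ℤ x
prime-∣-cofactor {p} {k} x prime-p 0<k k<p p∣kx
  with euclidsLemma k ∣ x ∣ prime-p (subst (p ∣ℕ_) (ℤP.abs-* (+ k) x) (Signed.∣⇒∣ᵤ p∣kx))
... | inj₁ p∣k = ⊥-elim (ℕP.<⇒≱ k<p (∣⇒≤ {{ℕ.>-nonZero 0<k}} p∣k))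
... | inj₂ p∣x = Signed.∣ᵤ⇒∣ p∣x

-- The algebra of one induction step of T-derivative: a, …, e are T(n, j-2), …, T(n, j+2),
-- and X, b + c + d, Z are the entries T(n+1, j-1), T(n+1, j), T(n+1, j+1).
derivative-step : ∀ j m a b c d e X Z → X ≡ a + b + c → Z ≡ c + d + e →
  (j - 1ℤ) * X ≡ m * (a - c) → j * (b + c + d) ≡ m * (b - d) → (j + 1ℤ) * Z ≡ m * (c - e) →
  j * (X + (b + c + d) + Z) ≡ (m + 1ℤ) * (X - Z)
derivative-step j m a b c d e _ _ refl refl left centre right = begin
  j * (X + Y + Z)
    ≡⟨ split j X Y Z ⟩
  (j - 1ℤ) * X + j * Y + (j + 1ℤ) * Z + (X - Z)
    ≡⟨ cong (_+ (X - Z)) (cong₂ _+_ (cong₂ _+_ left centre) right) ⟩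
  m * (a - c) + m * (b - d) + m * (c - e) + (X - Z)
    ≡⟨ telescope m a b c d e ⟩
  (m + 1ℤ) * (X - Z) ∎
  where
  X Y Z : ℤ
  X = a + b + c
  Y = b + c + d
  Z = c + d + e
  split : ∀ j X Y Z → j * (X + Y + Z) ≡ (j - 1ℤ) * X + j * Y + (j + 1ℤ) * Z + (X - Z)
  split = solve-∀
  telescope : ∀ m a b c d e →
    m * (a - c) + m * (b - d) + m * (c - e) + ((a + b + c) - (c + d + e)) ≡ (m + 1ℤ) * ((a + b + c) - (c + d + e))
  telescope = solve-∀

-- Differentiating (1 + x + x⁻¹)ⁿ⁺¹: j·T(n+1,j) = (n+1)·(T(n,j-1) - T(n,j+1)).
T-derivative : ∀ n j → j * Tℤ (suc n) j ≡ + suc n * (Tℤ n (j - 1ℤ) - Tℤ n (j + 1ℤ))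
T-derivative zero (+ zero)          = refl
T-derivative zero (+ suc zero)      = refl
T-derivative zero (+ suc (suc k))   = ℤP.*-zeroʳ (+ suc (suc k))
T-derivative zero -[1+ zero ]       = refl
T-derivative zero -[1+ suc k ]      = ℤP.*-zeroʳ -[1+ suc k ]
T-derivative (suc n) j = trans
  (derivative-step j m (A (j - 1ℤ - 1ℤ)) (A (j - 1ℤ)) (A j) (A (j + 1ℤ)) (A (j + 1ℤ + 1ℤ)) X Z
    X-split Z-split left (T-derivative n j) right)
  (cong (λ k → k * (X - Z)) (cong +_ (ℕP.+-comm (suc n) 1)))
  where
  m : ℤ
  m = + suc n
  A : ℤ → ℤ
  A = Tℤ n
  X Z : ℤ
  X = Tℤ (suc n) (j - 1ℤ)
  Z = Tℤ (suc n) (j + 1ℤ)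
  pred-succ : ∀ j → j - 1ℤ + 1ℤ ≡ j
  pred-succ = solve-∀
  succ-pred : ∀ j → j + 1ℤ - 1ℤ ≡ j
  succ-pred = solve-∀
  X-split : X ≡ A (j - 1ℤ - 1ℤ) + A (j - 1ℤ) + A j
  X-split = cong (λ i → A (j - 1ℤ - 1ℤ) + A (j - 1ℤ) + A i) (pred-succ j)
  Z-split : Z ≡ A j + A (j + 1ℤ) + A (j + 1ℤ + 1ℤ)
  Z-split = cong (λ i → A i + A (j + 1ℤ) + A (j + 1ℤ + 1ℤ)) (succ-pred j)
  left : (j - 1ℤ) * X ≡ m * (A (j - 1ℤ - 1ℤ) - A j)
  left = trans (T-derivative n (j - 1ℤ)) (cong (λ i → m * (A (j - 1ℤ - 1ℤ) - A i)) (pred-succ j))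
  right : (j + 1ℤ) * Z ≡ m * (A j - A (j + 1ℤ + 1ℤ))
  right = trans (T-derivative n (j + 1ℤ)) (cong (λ i → m * (A i - A (j + 1ℤ + 1ℤ))) (succ-pred j))

prime-∣-trinomial : ∀ {m} j → Prime (suc m) → 0 < j → j ≤ m → + suc m ∣ℤ Tℤ (suc m) (+ j)
prime-∣-trinomial {m} j prime-p 0<j j≤m = prime-∣-cofactor (Tℤ (suc m) (+ j)) prime-p 0<j (s≤s j≤m)
  (divides (Tℤ m (+ j - 1ℤ) - Tℤ m (+ j + 1ℤ))
    (trans (T-derivative m (+ j)) (ℤP.*-comm (+ suc m) _)))

C-absorption : ∀ n k → suc k ℕ.* (suc n C suc k) ≡ suc n ℕ.* (n C k)
C-absorption n       zero    =
  trans (ℕP.*-identityˡ (suc n C 1)) (trans (nC1≡n (suc n)) (sym (ℕP.*-identityʳ (suc n))))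
C-absorption zero    (suc k) =
  trans (cong (suc (suc k) ℕ.*_) (k>n⇒nCk≡0 {1} {suc (suc k)} (s≤s (s≤s ℕ.z≤n)))) (ℕP.*-zeroʳ (suc (suc k)))
C-absorption (suc n) (suc k) = begin
  suc (suc k) ℕ.* (suc (suc n) C suc (suc k))
    ≡⟨ cong (suc (suc k) ℕ.*_) (sym (nCk+nC[k+1]≡[n+1]C[k+1] (suc n) (suc k))) ⟩
  suc (suc k) ℕ.* (suc n C suc k ℕ.+ suc n C suc (suc k))
    ≡⟨ distribute k (suc n C suc k) (suc n C suc (suc k)) ⟩
  suc k ℕ.* (suc n C suc k) ℕ.+ suc n C suc k ℕ.+ suc (suc k) ℕ.* (suc n C suc (suc k))
    ≡⟨ cong₂ (λ x y → x ℕ.+ suc n C suc k ℕ.+ y) (C-absorption n k) (C-absorption n (suc k)) ⟩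
  suc n ℕ.* (n C k) ℕ.+ suc n C suc k ℕ.+ suc n ℕ.* (n C suc k)
    ≡⟨ cong (λ x → suc n ℕ.* (n C k) ℕ.+ x ℕ.+ suc n ℕ.* (n C suc k)) (sym (nCk+nC[k+1]≡[n+1]C[k+1] n k)) ⟩
  suc n ℕ.* (n C k) ℕ.+ (n C k ℕ.+ n C suc k) ℕ.+ suc n ℕ.* (n C suc k)
    ≡⟨ collect n (n C k) (n C suc k) ⟩
  suc (suc n) ℕ.* (n C k ℕ.+ n C suc k)
    ≡⟨ cong (suc (suc n) ℕ.*_) (nCk+nC[k+1]≡[n+1]C[k+1] n k) ⟩
  suc (suc n) ℕ.* (suc n C suc k) ∎
  where
  distribute : ∀ k a b → suc (suc k) ℕ.* (a ℕ.+ b) ≡ suc k ℕ.* a ℕ.+ a ℕ.+ suc (suc k) ℕ.* b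
  distribute = ℕSolver.solve-∀
  collect : ∀ n a b → suc n ℕ.* a ℕ.+ (a ℕ.+ b) ℕ.+ suc n ℕ.* b ≡ suc (suc n) ℕ.* (a ℕ.+ b)
  collect = ℕSolver.solve-∀

prime-∣-binomial : ∀ {m} k → Prime (suc m) → 0 < k → k ≤ m → + suc m ∣ℤ + (suc m C k)
prime-∣-binomial {m} (suc k) prime-p 0<k k<m = prime-∣-cofactor (+ (suc m C suc k)) prime-p 0<k (s≤s k<m)
  (divides (+ (m C k)) (begin
    + suc k * + (suc m C suc k)  ≡⟨ ℤP.pos-* (suc k) _ ⟨
    + (suc k ℕ.* (suc m C suc k)) ≡⟨ cong +_ (trans (C-absorption m k) (ℕP.*-comm (suc m) (m C k))) ⟩
    + ((m C k) ℕ.* suc m)        ≡⟨ ℤP.pos-* (m C k) (suc m) ⟩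
    + (m C k) * + suc m          ∎))

Δ : ℕ → (ℤ → ℤ) → ℤ → ℤ
Δ zero    t s = t s
Δ (suc m) t s = Δ m t s - Δ m t (s + 1ℤ)

sign : ℕ → ℤ
sign k = -1ℤ ℤ.^ k

signed-pascal : ∀ m k → sign (suc k) * + (suc m C suc k) ≡ sign (suc k) * + (m C suc k) - sign k * + (m C k)
signed-pascal m k = begin
  sign (suc k) * + (suc m C suc k)
    ≡⟨ cong (λ c → sign (suc k) * + c) (nCk+nC[k+1]≡[n+1]C[k+1] m k) ⟨
  -1ℤ * sign k * (+ (m C k) + + (m C suc k))
    ≡⟨ expand (sign k) (+ (m C k)) (+ (m C suc k)) ⟩
  -1ℤ * sign k * + (m C suc k) - sign k * + (m C k) ∎
  where
  expand : ∀ s a b → -1ℤ * s * (a + b) ≡ -1ℤ * s * b - s * a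
  expand = solve-∀

Δ-binomial : ∀ m t s → Δ m t s ≡ ∑ (suc m) (λ k → sign k * + (m C k) * t (s + + k))
Δ-binomial zero    t s = sym (trans (ℤP.+-identityʳ _) (trans (ℤP.*-identityˡ _) (cong t (ℤP.+-identityʳ s))))
Δ-binomial (suc m) t s = begin
  Δ m t s - Δ m t (s + 1ℤ)
    ≡⟨ cong₂ _-_ (Δ-binomial m t s) (Δ-binomial m t (s + 1ℤ)) ⟩
  ∑ (suc m) (term s) - ∑ (suc m) (term (s + 1ℤ))
    ≡⟨ cong₂ _-_ extend (∑-cong (suc m) shift) ⟩
  (term s 0 + ∑ (suc m) (λ k → term s (suc k))) - ∑ (suc m) next
    ≡⟨ ℤP.+-assoc (term s 0) _ _ ⟩
  term s 0 + (∑ (suc m) (λ k → term s (suc k)) - ∑ (suc m) next)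
    ≡⟨ cong (λ x → term s 0 + x) (∑-- (suc m) (λ k → term s (suc k)) next) ⟨
  term s 0 + ∑ (suc m) (λ k → term s (suc k) - next k)
    ≡⟨ cong (λ x → term s 0 + x) (∑-cong (suc m) pascal) ⟩
  ∑ (suc (suc m)) (λ k → sign k * + (suc m C k) * t (s + + k)) ∎
  where
  term : ℤ → ℕ → ℤ
  term s k = sign k * + (m C k) * t (s + + k)
  next : ℕ → ℤ
  next k = sign k * + (m C k) * t (s + + suc k)
  -- the term k = m + 1 vanishes, so the sum may be extended by one
  extend : ∑ (suc m) (term s) ≡ ∑ (suc (suc m)) (term s)
  extend = sym (begin
    ∑ (suc (suc m)) (term s)        ≡⟨ ∑-last (suc m) (term s) ⟩
    ∑ (suc m) (term s) + term s (suc m)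
      ≡⟨ cong (λ c → ∑ (suc m) (term s) + sign (suc m) * + c * t (s + + suc m))
              (k>n⇒nCk≡0 {m} {suc m} ℕP.≤-refl) ⟩
    ∑ (suc m) (term s) + sign (suc m) * 0ℤ * t (s + + suc m)
      ≡⟨ cong (λ x → ∑ (suc m) (term s) + x * t (s + + suc m)) (ℤP.*-zeroʳ (sign (suc m))) ⟩
    ∑ (suc m) (term s) + 0ℤ         ≡⟨ ℤP.+-identityʳ _ ⟩
    ∑ (suc m) (term s)              ∎)
  shift : ∀ k → term (s + 1ℤ) k ≡ next k
  shift k = cong (λ i → sign k * + (m C k) * t i) (reassoc s (+ k))
    where
    reassoc : ∀ s k → s + 1ℤ + k ≡ s + (1ℤ + k)
    reassoc = solve-∀
  pascal : ∀ k → term s (suc k) - next k ≡ sign (suc k) * + (suc m C suc k) * t (s + + suc k)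
  pascal k = begin
    sign (suc k) * + (m C suc k) * u - sign k * + (m C k) * u
      ≡⟨ factor (sign (suc k) * + (m C suc k)) (sign k * + (m C k)) u ⟩
    (sign (suc k) * + (m C suc k) - sign k * + (m C k)) * u
      ≡⟨ cong (_* u) (signed-pascal m k) ⟨
    sign (suc k) * + (suc m C suc k) * u ∎
    where
    u : ℤ
    u = t (s + + suc k)
    factor : ∀ a b u → a * u - b * u ≡ (a - b) * u
    factor = solve-∀

-- The neighbour sum t(s-1) + t(s) + t(s+1), i.e. multiplication by x⁻¹ + 1 + x;
-- Tℤ (n+1) is nbr (Tℤ n) by definition of T.
nbr : (ℤ → ℤ) → ℤ → ℤ
nbr t s = t (s - 1ℤ) + t s + t (s + 1ℤ)

-- Δᵐ⁺¹ ∘ nbr = Δᵐ ∘ (x⁻¹ - x²): the neighbour sum telescopes against one difference.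
Δ-nbr : ∀ m t s → Δ (suc m) (nbr t) s ≡ Δ m t (s - 1ℤ) - Δ m t (s + 1ℤ + 1ℤ)
Δ-nbr zero    t s = telescope s
  where
  telescope : ∀ s → nbr t s - nbr t (s + 1ℤ) ≡ t (s - 1ℤ) - t (s + 1ℤ + 1ℤ)
  telescope s = begin
    t (s - 1ℤ) + t s + t (s + 1ℤ) - (t (s + 1ℤ - 1ℤ) + t (s + 1ℤ) + t (s + 1ℤ + 1ℤ))
      ≡⟨ cong (λ i → t (s - 1ℤ) + t s + t (s + 1ℤ) - (t i + t (s + 1ℤ) + t (s + 1ℤ + 1ℤ))) (succ-pred s) ⟩
    t (s - 1ℤ) + t s + t (s + 1ℤ) - (t s + t (s + 1ℤ) + t (s + 1ℤ + 1ℤ))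
      ≡⟨ cancel (t (s - 1ℤ)) (t s) (t (s + 1ℤ)) (t (s + 1ℤ + 1ℤ)) ⟩
    t (s - 1ℤ) - t (s + 1ℤ + 1ℤ) ∎
    where
    succ-pred : ∀ s → s + 1ℤ - 1ℤ ≡ s
    succ-pred = solve-∀
    cancel : ∀ a b c d → a + b + c - (b + c + d) ≡ a - d
    cancel = solve-∀
Δ-nbr (suc m) t s = begin
  Δ (suc m) (nbr t) s - Δ (suc m) (nbr t) (s + 1ℤ)
    ≡⟨ cong₂ _-_ (Δ-nbr m t s) (Δ-nbr m t (s + 1ℤ)) ⟩
  (D (s - 1ℤ) - D (s + 1ℤ + 1ℤ)) - (D (s + 1ℤ - 1ℤ) - D (s + 1ℤ + 1ℤ + 1ℤ))
    ≡⟨ cong (λ i → (D (s - 1ℤ) - D (s + 1ℤ + 1ℤ)) - (D i - D (s + 1ℤ + 1ℤ + 1ℤ))) (shift s) ⟩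
  (D (s - 1ℤ) - D (s + 1ℤ + 1ℤ)) - (D (s - 1ℤ + 1ℤ) - D (s + 1ℤ + 1ℤ + 1ℤ))
    ≡⟨ swap (D (s - 1ℤ)) (D (s + 1ℤ + 1ℤ)) (D (s - 1ℤ + 1ℤ)) (D (s + 1ℤ + 1ℤ + 1ℤ)) ⟩
  (D (s - 1ℤ) - D (s - 1ℤ + 1ℤ)) - (D (s + 1ℤ + 1ℤ) - D (s + 1ℤ + 1ℤ + 1ℤ)) ∎
  where
  D : ℤ → ℤ
  D = Δ m t
  shift : ∀ s → s + 1ℤ - 1ℤ ≡ s - 1ℤ + 1ℤ
  shift = solve-∀
  swap : ∀ a b c d → (a - b) - (c - d) ≡ (a - c) - (b - d)
  swap = solve-∀

-- Δⁿ T(n,·) (s) = 0 unless s ≡ n (mod 3): row 0 is the indicator of 0, and by Δ-nbr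
-- passing from n to n + 1 only looks at the points s - 1 and s + 2.
Δ-row-vanish : ∀ n s → ¬ (+ 3 ∣ℤ s - + n) → Δ n (Tℤ n) s ≡ 0ℤ
Δ-row-vanish zero    s 3∤s = cong +_ (T-row₀ s (λ { refl → 3∤s (divides 0ℤ refl) }))
Δ-row-vanish (suc n) s 3∤s = begin
  Δ (suc n) (nbr (Tℤ n)) s
    ≡⟨ Δ-nbr n (Tℤ n) s ⟩
  Δ n (Tℤ n) (s - 1ℤ) - Δ n (Tℤ n) (s + 1ℤ + 1ℤ)
    ≡⟨ cong₂ _-_ (Δ-row-vanish n (s - 1ℤ) 3∤left) (Δ-row-vanish n (s + 1ℤ + 1ℤ) 3∤right) ⟩
  0ℤ ∎
  where
  left-index : ∀ s n → s - 1ℤ - n ≡ s - (1ℤ + n)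
  left-index = solve-∀
  right-index : ∀ s n → s + 1ℤ + 1ℤ - n ≡ s - (1ℤ + n) + + 3
  right-index = solve-∀
  3∤left : ¬ (+ 3 ∣ℤ s - 1ℤ - + n)
  3∤left 3∣ = 3∤s (subst (+ 3 ∣ℤ_) (left-index s (+ n)) 3∣)
  3∤right : ¬ (+ 3 ∣ℤ s + 1ℤ + 1ℤ - + n)
  3∤right 3∣ = 3∤s (Signed.∣m+n∣n⇒∣m (subst (+ 3 ∣ℤ_) (right-index s (+ n)) 3∣) Signed.∣-refl)

prime-∤ : ∀ {p d} → Prime p → 1 < d → d < p → ¬ d ∣ℕ p
prime-∤ {d = suc (suc _)} prime-p (s≤s (s≤s _)) d<p d∣p = Prime.notComposite prime-p (composite d<p d∣p)

odd-prime : ∀ {p} → Prime p → 2 < p → p ≡ suc ((p / 2) ℕ.* 2)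
odd-prime {p} prime-p 2<p with p % 2 in p%2≡r | m%n<n p 2
... | zero        | _ = ⊥-elim (prime-∤ prime-p (s≤s (s≤s ℕ.z≤n)) 2<p (m%n≡0⇒n∣m p 2 p%2≡r))
... | suc zero    | _ = trans (m≡m%n+[m/n]*n p 2) (cong (ℕ._+ (p / 2) ℕ.* 2) p%2≡r)
... | suc (suc _) | s≤s (s≤s ())

sign-odd : ∀ d → sign (suc (d ℕ.* 2)) ≡ -1ℤ
sign-odd zero    = refl
sign-odd (suc d) = cong (λ x → -1ℤ * (-1ℤ * x)) (sign-odd d)

-- T(p,0) ≡ 1 (mod p²) for a prime p = m + 1 ≥ 5: in the vanishing alternating sum
-- Σ_{k=0}^{p} (-1)ᵏ C(p,k) T(p,k) the terms 0 < k < p are divisible by p², the last is -1.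
central-mod-p² : ∀ m → Prime (suc m) → 5 ≤ suc m → + suc m * + suc m ∣ℤ Tℤ (suc m) (+ 0) - 1ℤ
central-mod-p² m prime-p 5≤p = subst (+ p * + p ∣ℤ_) solve-for-T (Signed.∣m⇒∣-m middle-divisible)
  where
  p : ℕ
  p = suc m
  term : ℕ → ℤ
  term k = sign k * + (p C k) * Tℤ p (0ℤ + + k)
  middle : ℤ
  middle = ∑ m (λ k → term (suc k))
  3∤p : ¬ (+ 3 ∣ℤ 0ℤ - + p)
  3∤p 3∣p = prime-∤ prime-p (s≤s (s≤s ℕ.z≤n)) (ℕP.<-≤-trans (s≤s (s≤s (s≤s (s≤s ℕ.z≤n)))) 5≤p)
                    (Signed.∣⇒∣ᵤ 3∣p)
  alternating : Tℤ p (+ 0) + (middle + -1ℤ) ≡ 0ℤ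
  alternating = begin
    Tℤ p (+ 0) + (middle + -1ℤ)
      ≡⟨ cong₂ (λ a b → a + (middle + b)) (sym (ℤP.*-identityˡ (Tℤ p (+ 0)))) (sym last) ⟩
    term 0 + (middle + term p)   ≡⟨ cong (λ x → term 0 + x) (∑-last m (λ k → term (suc k))) ⟨
    ∑ (suc p) term               ≡⟨ Δ-binomial p (Tℤ p) 0ℤ ⟨
    Δ p (Tℤ p) 0ℤ                ≡⟨ Δ-row-vanish p 0ℤ 3∤p ⟩
    0ℤ                           ∎
    where
    last : term p ≡ -1ℤ
    last = begin
      sign p * + (p C p) * Tℤ p (+ p)
        ≡⟨ cong₂ (λ c t → sign p * + c * + t) (nCn≡1 p) (T-top p) ⟩
      sign p * 1ℤ * 1ℤ
        ≡⟨ cong (λ s → s * 1ℤ * 1ℤ) (trans (cong sign (odd-prime prime-p 2<p)) (sign-odd (p / 2))) ⟩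
      -1ℤ ∎
      where
      2<p : 2 < p
      2<p = ℕP.<-≤-trans (s≤s (s≤s (s≤s ℕ.z≤n))) 5≤p
  -- p ∣ C(p,k) and p ∣ T(p,k) for 0 < k < p, so p² ∣ (-1)ᵏ·C(p,k)·T(p,k)
  middle-term : ∀ k → k < m → + p * + p ∣ℤ term (suc k)
  middle-term k k<m = subst (+ p * + p ∣ℤ_) (sym (ℤP.*-assoc (sign (suc k)) _ _))
    (Signed.∣n⇒∣m*n (sign (suc k)) (Signed.∣-trans (Signed.*-monoʳ-∣ (+ p) p∣T) (Signed.*-monoˡ-∣ (Tℤ p (+ suc k)) p∣C)))
    where
    p∣C : + p ∣ℤ + (p C suc k)
    p∣C = prime-∣-binomial (suc k) prime-p (s≤s ℕ.z≤n) k<m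
    p∣T : + p ∣ℤ Tℤ p (+ suc k)
    p∣T = prime-∣-trinomial (suc k) prime-p (s≤s ℕ.z≤n) k<m
  middle-divisible : + p * + p ∣ℤ middle
  middle-divisible = ∑-divisible m (λ k → term (suc k)) middle-term
  solve-for-T : - middle ≡ Tℤ p (+ 0) - 1ℤ
  solve-for-T = begin
    - middle                                       ≡⟨ isolate (Tℤ p (+ 0)) middle ⟩
    Tℤ p (+ 0) - 1ℤ - (Tℤ p (+ 0) + (middle + -1ℤ)) ≡⟨ cong (λ x → Tℤ p (+ 0) - 1ℤ - x) alternating ⟩
    Tℤ p (+ 0) - 1ℤ - 0ℤ                           ≡⟨ ℤP.+-identityʳ _ ⟩
    Tℤ p (+ 0) - 1ℤ                                ∎
    where
    isolate : ∀ t M → - M ≡ t - 1ℤ - (t + (M + -1ℤ))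
    isolate = solve-∀

-- Fermat's theorem 3ᵖ⁻¹ ≡ 1 (mod p), read off from row p = m + 1: the half row sum is
-- T(p,0) + (a multiple of p) + 1, twice it is 3ᵖ + T(p,0), and T(p,0) ≡ 1.
fermat-3 : ∀ m → Prime (suc m) → 5 ≤ suc m → + suc m ∣ℤ + (3 ^ m) - 1ℤ
fermat-3 m prime-p 5≤p = prime-∣-cofactor (+ (3 ^ m) - 1ℤ) prime-p (s≤s ℕ.z≤n) 3<p
  (subst (+ p ∣ℤ_) (sym three-times) (Signed.∣m∣n⇒∣m+n p∣t-1 p∣2M))
  where
  p : ℕ
  p = suc m
  t M : ℤ
  t = Tℤ p (+ 0)
  M = ∑ m (λ j → Tℤ p (+ suc j))
  3<p : 3 < p
  3<p = ℕP.<-≤-trans (s≤s (s≤s (s≤s (s≤s ℕ.z≤n)))) 5≤p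
  row : rowSum p ≡ t + (M + 1ℤ)
  row = cong (λ x → t + x) (trans (∑-last m (λ j → Tℤ p (+ suc j))) (cong (λ x → M + + x) (T-top p)))
  three-times : + 3 * (+ (3 ^ m) - 1ℤ) ≡ (t - 1ℤ) + + 2 * M
  three-times = begin
    + 3 * (+ (3 ^ m) - 1ℤ)               ≡⟨ shift (+ (3 ^ m)) t ⟩
    (+ 3 * + (3 ^ m) + t) - (t + + 3)     ≡⟨ cong (λ x → (x + t) - (t + + 3)) (ℤP.pos-* 3 (3 ^ m)) ⟨
    (+ (3 ^ p) + t) - (t + + 3)
      ≡⟨ cong (λ x → x - (t + + 3)) (trans (sym (rowSum-doubled p)) (cong (λ x → + 2 * x) row)) ⟩
    + 2 * (t + (M + 1ℤ)) - (t + + 3)      ≡⟨ collect t M ⟩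
    (t - 1ℤ) + + 2 * M                    ∎
    where
    shift : ∀ P t → + 3 * (P - 1ℤ) ≡ (+ 3 * P + t) - (t + + 3)
    shift = solve-∀
    collect : ∀ t M → + 2 * (t + (M + 1ℤ)) - (t + + 3) ≡ (t - 1ℤ) + + 2 * M
    collect = solve-∀
  p∣t-1 : + p ∣ℤ t - 1ℤ
  p∣t-1 = Signed.∣-trans (Signed.∣m⇒∣m*n (+ p) Signed.∣-refl) (central-mod-p² m prime-p 5≤p)
  p∣2M : + p ∣ℤ + 2 * M
  p∣2M = Signed.∣n⇒∣m*n (+ 2)
    (∑-divisible m (λ j → Tℤ p (+ suc j)) (λ k k<m → prime-∣-trinomial (suc k) prime-p (s≤s ℕ.z≤n) k<m))

-- The 3-periodic sequence χ(k) = ((k+1)/3) = 1, -1, 0, 1, -1, 0, ….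
χ : ℕ → ℤ
χ k = legendre3 (suc k)

-- χ(k+2) + χ(k+1) + χ(k) = 0; since legendre3 (n + 3) computes to legendre3 n,
-- checking one period suffices.
χ-recurrence : ∀ k → χ (2 ℕ.+ k) + χ (1 ℕ.+ k) + χ k ≡ 0ℤ
χ-recurrence zero                = refl
χ-recurrence (suc zero)          = refl
χ-recurrence (suc (suc zero))    = refl
χ-recurrence (suc (suc (suc k))) = χ-recurrence k

recurrence-χ : ∀ {d} N (g : ℕ → ℤ) → g 0 ≡ 1ℤ → d ∣ℤ g 1 + g 0 →
  (∀ k → 2 ℕ.+ k ≤ N → d ∣ℤ g (2 ℕ.+ k) + g (1 ℕ.+ k) + g k) →
  ∀ k → k ≤ N → d ∣ℤ g k - χ k
recurrence-χ {d} N g g₀ d∣g₁+g₀ d∣rec = agree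
  where
  agree₀ : d ∣ℤ g 0 - χ 0
  agree₀ = subst (λ x → d ∣ℤ x - 1ℤ) (sym g₀) (divides 0ℤ refl)
  -- agreement at two consecutive places, propagated by the recurrence
  agree₂ : ∀ k → suc k ≤ N → d ∣ℤ g k - χ k × d ∣ℤ g (suc k) - χ (suc k)
  agree₂ zero    _ = agree₀ , subst (d ∣ℤ_) (sym (first-step (g 1) (g 0))) (Signed.∣m∣n⇒∣m-n d∣g₁+g₀ agree₀)
    where
    first-step : ∀ a b → a - -1ℤ ≡ (a + b) - (b - 1ℤ)
    first-step = solve-∀
  agree₂ (suc k) 2+k≤N with agree₂ k (ℕP.≤-trans (ℕP.n≤1+n (suc k)) 2+k≤N)
  ... | agree-k , agree-k+1 = agree-k+1 , subst (d ∣ℤ_) (sym (step a b c x y z))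
      (Signed.∣m∣n⇒∣m-n (Signed.∣m∣n⇒∣m-n (Signed.∣m∣n⇒∣m-n (d∣rec k 2+k≤N) agree-k+1) agree-k) d∣χ-sum)
    where
    a b c x y z : ℤ
    a = g (2 ℕ.+ k)
    b = g (1 ℕ.+ k)
    c = g k
    x = χ (2 ℕ.+ k)
    y = χ (1 ℕ.+ k)
    z = χ k
    d∣χ-sum : d ∣ℤ x + y + z
    d∣χ-sum = subst (d ∣ℤ_) (sym (χ-recurrence k)) (divides 0ℤ refl)
    step : ∀ a b c x y z → a - x ≡ (a + b + c) - (b - y) - (c - z) - (x + y + z)
    step = solve-∀
  agree : ∀ k → k ≤ N → d ∣ℤ g k - χ k
  agree zero    _     = agree₀
  agree (suc k) k+1≤N = proj₂ (agree₂ k k+1≤N)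

∸-unfold : ∀ {m k} → k < m → m ∸ k ≡ suc (m ∸ suc k)
∸-unfold {suc m} (s≤s k≤m) = ℕP.+-∸-assoc 1 k≤m

-- T(p-1,0) ≡ (p/3) (mod p) for a prime p = m + 1: modulo p the numbers g(k) = T(m, m-k)
-- obey the recurrence of χ, as T(p, m-k) = g(k+1) + g(k) + g(k-1) is divisible by p.
row-below-prime : ∀ m → Prime (suc m) → + suc m ∣ℤ Tℤ m (+ 0) - legendre3 (suc m)
row-below-prime zero          prime-1 = ⊥-elim (¬prime[1] prime-1)
row-below-prime m@(suc m′) prime-p =
  subst (λ i → + p ∣ℤ Tℤ m (+ i) - χ m) (ℕP.n∸n≡0 m) (recurrence-χ m g g₀ p∣g₁+g₀ p∣rec m ℕP.≤-refl)
  where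
  p : ℕ
  p = suc m
  g : ℕ → ℤ
  g k = Tℤ m (+ (m ∸ k))
  g₀ : g 0 ≡ 1ℤ
  g₀ = cong +_ (T-top m)
  -- T(p,m) = g(1) + g(0) + T(m,m+1), and the last entry vanishes
  p∣g₁+g₀ : + p ∣ℤ g 1 + g 0
  p∣g₁+g₀ = subst (+ p ∣ℤ_)
    (trans (cong (λ x → g 1 + g 0 + + x) (T-vanish m (m ℕ.+ 1) (ℕP.m<m+n m (s≤s ℕ.z≤n)))) (ℤP.+-identityʳ _))
    (prime-∣-trinomial m prime-p (s≤s ℕ.z≤n) ℕP.≤-refl)
  -- with j = m - (k+1): T(p,j) = T(m,j-1) + T(m,j) + T(m,j+1) = g(k+2) + g(k+1) + g(k)
  p∣rec : ∀ k → 2 ℕ.+ k ≤ m → + p ∣ℤ g (2 ℕ.+ k) + g (1 ℕ.+ k) + g k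
  p∣rec k 2+k≤m = subst (+ p ∣ℤ_) (cong₂ (λ a b → Tℤ m a + g (1 ℕ.+ k) + Tℤ m b) below above)
    (prime-∣-trinomial j prime-p 0<j (ℕP.m∸n≤m m (suc k)))
    where
    j : ℕ
    j = m ∸ suc k
    j≡ : j ≡ suc (m ∸ (2 ℕ.+ k))
    j≡ = ∸-unfold 2+k≤m
    0<j : 0 < j
    0<j = subst (0 <_) (sym j≡) (s≤s ℕ.z≤n)
    below : + j - 1ℤ ≡ + (m ∸ (2 ℕ.+ k))
    below = cong (λ i → + i - 1ℤ) j≡
    above : + j + 1ℤ ≡ + (m ∸ k)
    above = cong +_ (trans (ℕP.+-comm j 1) (sym (∸-unfold (ℕP.<-trans (ℕP.n<1+n k) 2+k≤m))))

sumT-doubled : ∀ n → + 2 * + sumT n n ≡ + (3 ^ n) + Tℤ n (+ 0)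
sumT-doubled n = trans (cong (λ x → + 2 * x) (sumT-as-rowSum n)) (rowSum-doubled n)

theorem2 : ∀ (p : ℕ) → Prime p → p ≥ 5 →
    ((+ (p ^ 2)) ∣ ((+ 2) * (+ sumT p p) - (1ℤ + (+ (3 ^ p)))))
    × ((+ p) ∣ ((+ 2) * (+ sumT (p ∸ 1) (p ∸ 1)) - (1ℤ + legendre3 p)))
theorem2 p@(suc m) prime-p 5≤p = Signed.∣⇒∣ᵤ first , Signed.∣⇒∣ᵤ second
  where
  first : + (p ^ 2) ∣ℤ + 2 * + sumT p p - (1ℤ + + (3 ^ p))
  first = subst₂ _∣ℤ_ (sym p²) (sym reduce) (central-mod-p² m prime-p 5≤p)
    where
    p² : + (p ^ 2) ≡ + p * + p
    p² = trans (cong (λ x → + (p ℕ.* x)) (ℕP.*-identityʳ p)) (ℤP.pos-* p p)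
    cancel : ∀ P t → P + t - (1ℤ + P) ≡ t - 1ℤ
    cancel = solve-∀
    reduce : + 2 * + sumT p p - (1ℤ + + (3 ^ p)) ≡ Tℤ p (+ 0) - 1ℤ
    reduce = trans (cong (λ x → x - (1ℤ + + (3 ^ p))) (sumT-doubled p)) (cancel (+ (3 ^ p)) (Tℤ p (+ 0)))
  second : + p ∣ℤ + 2 * + sumT m m - (1ℤ + legendre3 p)
  second = subst (+ p ∣ℤ_) (sym reduce)
    (Signed.∣m∣n⇒∣m+n (fermat-3 m prime-p 5≤p) (row-below-prime m prime-p))
    where
    regroup : ∀ P t L → P + t - (1ℤ + L) ≡ (P - 1ℤ) + (t - L)
    regroup = solve-∀
    reduce : + 2 * + sumT m m - (1ℤ + legendre3 p) ≡ (+ (3 ^ m) - 1ℤ) + (Tℤ m (+ 0) - legendre3 p)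
    reduce = trans (cong (λ x → x - (1ℤ + legendre3 p)) (sumT-doubled m))
                   (regroup (+ (3 ^ m)) (Tℤ m (+ 0)) (legendre3 p))
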